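{- Let $n=p_1^{n_1}\cdots p_r^{n_r}$ with $r\geq 3$, primes $p_1<\cdots<p_r$ and positive integers $n_i$; put $P=p_1\cdots p_r$. Let $a,b\in[r]$ with $a\neq b$ and $n_b\geq 2$. Put $\alpha:=\left(2+\frac{p_a^{n_a}-2}{p_b}\right)\phi\left(\frac{P}{p_ap_b}\right)-\frac{P}{p_ap_b}$. Then: (i) If $\alpha=0$, then $\beta_a^{n_a}=\theta_{a,b}^{n_a,1}=\theta_{a,b}^{n_a,2}=\cdots=\theta_{a,b}^{n_a,n_b-1}$. (ii) If $\alpha<0$, then $\beta_a^{n_a}>\theta_{a,b}^{n_a,1}>\theta_{a,b}^{n_a,2}>\cdots>\theta_{a,b}^{n_a,n_b-1}$. (iii) If $\alpha>0$, then $\beta_a^{n_a}<\theta_{a,b}^{n_a,1}<\theta_{a,b}^{n_a,2}<\cdots<\theta_{a,b}^{n_a,n_b-1}$.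
   Context: $\phi$ is Euler's totient function. $\beta_a^{n_a}:=\phi(n)+\frac{n}{P}\cdot\frac{1}{p_a^{n_a-1}}\left[\frac{P}{p_a}+\phi\left(\frac{P}{p_a}\right)(p_a^{n_a-1}-2)\right]$. For $1\le t\le n_b-1$, $$\theta_{a,b}^{n_a,t}:=\phi(n)+\frac{n}{P}\left[\phi\left(\frac{P}{p_ap_b}\right)\left(1-\frac{1}{p_b^t}\right)+\phi\left(\frac{P}{p_a}\right)\left(1-\frac{2}{p_a^{n_a-1}p_b^t}\right)+\phi\left(\frac{P}{p_b}\right)\left(1-\frac{1}{p_b^t}\right)+\frac{P}{p_a^{n_a}p_b^t}\right].$$ (This is the size of a certain cut-set $X_{a,b}^{n_a,t}$ of the power graph of $C_n$.) -}

module Defs where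

open import Data.Nat as ℕ using (ℕ; zero; suc; _^_; _∸_)
open import Data.Nat.GCD using (gcd)
open import Data.Nat.DivMod as DM using ()
open import Data.Integer using (+_)
open import Data.Rational using (ℚ; _/_; _+_; _*_; _-_)
open import Data.List using (List; length; filter; map; upTo; allFin)
open import Data.Nat.ListAction using (product)
open import Data.Fin using (Fin)
open import Relation.Nullary.Decidable using (does)

φ : ℕ → ℕ
φ m = length (filter (λ k → gcd k m ℕ.≟ 1) (map suc (upTo m)))

-- Natural-number division, total (division by 0 returns 0; never used with 0 here).
div : ℕ → ℕ → ℕ
div m zero = 0
div m (suc k) = m DM./ suc k

-- The rational m/d (d = 0 gives 0; never used with d = 0 here).
frac : ℕ → ℕ → ℚ
frac m zero = + 0 / 1
frac m (suc k) = + m / suc k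

q : ℕ → ℚ
q m = + m / 1

module Setup {r : ℕ} (p e : Fin r → ℕ) where

  N : ℕ
  N = product (map (λ i → p i ^ e i) (allFin r))

  P : ℕ
  P = product (map p (allFin r))

  β : Fin r → ℚ
  β a = q (φ N) + frac N P * frac 1 (p a ^ (e a ∸ 1))
          * (q (div P (p a)) + q (φ (div P (p a))) * (q (p a ^ (e a ∸ 1)) - q 2))

  θ : Fin r → Fin r → ℕ → ℚ
  θ a b t = q (φ N) + frac N P *
      ( q (φ (div P (p a ℕ.* p b))) * (q 1 - frac 1 (p b ^ t))
      + q (φ (div P (p a))) * (q 1 - frac 2 (p a ^ (e a ∸ 1) ℕ.* p b ^ t))
      + q (φ (div P (p b))) * (q 1 - frac 1 (p b ^ t))
      + frac P (p a ^ e a ℕ.* p b ^ t) )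

  α : Fin r → Fin r → ℚ
  α a b = (q 2 + (q (p a ^ e a) - q 2) * frac 1 (p b)) * q (φ (div P (p a ℕ.* p b)))
          - q (div P (p a ℕ.* p b))

-- Write P = p_a p_b P′ with p_a, p_b ∤ P′, put m = p_a^(n_a−1), A = φ(P′) and W = P′. Since φ(pk) = (p − 1)φ(k)
-- for a prime p ∤ k, φ(P/p_a) = (p_b − 1)A and φ(P/p_b) = (p_a − 1)A, and substituting into the definitions gives
--   θ_{a,b}^{n_a,t} = β_a^{n_a} + (n/P)(p_b/m) α (1 − p_b^(−t))   for every t ≥ 0.
-- As p_b^(−t) strictly decreases and equals 1 at t = 0, the sign of α decides whether β, θ^1, θ^2, … is constant,
-- decreasing or increasing.

module Submission where

open import Defs

module Totient where
  open import Data.Bool.Base using (true; false; if_then_else_)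
  open import Data.Nat.Base
  open import Data.Nat.Properties
  open import Data.Nat.GCD using (gcd)
  open import Data.Nat.Divisibility
  open import Data.Nat.Coprimality as Coprime using (Coprime; coprime?; coprime-+)
  open import Data.Nat.Primality using (Prime; prime⇒irreducible; prime⇒nonTrivial; prime⇒nonZero)
  open import Data.Nat.Tactic.RingSolver using (solve-∀)
  open import Data.List.Base using (length; filter; applyUpTo)
  open import Data.List.Properties using (map-upTo)
  open import Data.Product.Base using (_,_; _×_; proj₁; proj₂)
  open import Data.Sum.Base using ([_,_]′)
  open import Function.Base using (_∘_)
  open import Function.Bundles using (_⇔_; mk⇔; Equivalence)
  open import Relation.Nullary using (¬_; Dec; does; yes; no; contradiction)
  open import Relation.Nullary.Decidable using (dec-true; dec-false)
  open import Relation.Unary using (Decidable)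
  open import Relation.Binary.PropositionalEquality

  iverson : ∀ {a} {A : Set a} → Dec A → ℕ
  iverson a? = if does a? then 1 else 0

  iverson-yes : ∀ {a} {A : Set a} (a? : Dec A) → A → iverson a? ≡ 1
  iverson-yes a? x rewrite dec-true a? x = refl

  iverson-no : ∀ {a} {A : Set a} (a? : Dec A) → ¬ A → iverson a? ≡ 0
  iverson-no a? ¬x rewrite dec-false a? ¬x = refl

  iverson-cong : ∀ {a b} {A : Set a} {B : Set b} (a? : Dec A) (b? : Dec B) → A ⇔ B → iverson a? ≡ iverson b?
  iverson-cong a? b? A⇔B with a?
  ... | yes x = sym (iverson-yes b? (Equivalence.to A⇔B x))
  ... | no ¬x = sym (iverson-no b? (¬x ∘ Equivalence.from A⇔B))

  ∑< : ℕ → (ℕ → ℕ) → ℕ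
  ∑< zero    f = 0
  ∑< (suc n) f = f 0 + ∑< n (f ∘ suc)

  ∑<-cong : ∀ n {f g} → (∀ i → i < n → f i ≡ g i) → ∑< n f ≡ ∑< n g
  ∑<-cong zero    f≗g = refl
  ∑<-cong (suc n) f≗g = cong₂ _+_ (f≗g 0 z<s) (∑<-cong n (λ i i<n → f≗g (suc i) (s<s i<n)))

  ∑<-zero : ∀ n {f} → (∀ i → i < n → f i ≡ 0) → ∑< n f ≡ 0
  ∑<-zero zero    f≗0 = refl
  ∑<-zero (suc n) f≗0 = cong₂ _+_ (f≗0 0 z<s) (∑<-zero n (λ i i<n → f≗0 (suc i) (s<s i<n)))

  ∑<-+ : ∀ m n f → ∑< (m + n) f ≡ ∑< m f + ∑< n (λ i → f (m + i))
  ∑<-+ zero    n f = refl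
  ∑<-+ (suc m) n f = trans (cong (f 0 +_) (∑<-+ m n (f ∘ suc))) (sym (+-assoc (f 0) _ _))

  ∑<-distrib : ∀ n f g → ∑< n (λ i → f i + g i) ≡ ∑< n f + ∑< n g
  ∑<-distrib zero    f g = refl
  ∑<-distrib (suc n) f g =
    trans (cong (f 0 + g 0 +_) (∑<-distrib n (f ∘ suc) (g ∘ suc))) (interchange (f 0) (g 0) _ _)
    where
    interchange : ∀ a b c d → a + b + (c + d) ≡ a + c + (b + d)
    interchange = solve-∀

  ∑<-periodic : ∀ m j {f} → (∀ i → f (m + i) ≡ f i) → ∑< (j * m) f ≡ j * ∑< m f
  ∑<-periodic m zero    periodic = refl
  ∑<-periodic m (suc j) {f} periodic = begin
    ∑< (m + j * m) f                         ≡⟨ ∑<-+ m (j * m) f ⟩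
    ∑< m f + ∑< (j * m) (λ i → f (m + i))    ≡⟨ cong (∑< m f +_) (∑<-cong (j * m) (λ i _ → periodic i)) ⟩
    ∑< m f + ∑< (j * m) f                    ≡⟨ cong (∑< m f +_) (∑<-periodic m j periodic) ⟩
    ∑< m f + j * ∑< m f                      ∎
    where open ≡-Reasoning

  ∑<-multiples-block : ∀ p .{{_ : NonZero p}} (h : ℕ → ℕ) → ∑< p (λ i → iverson (p ∣? suc i) * h (suc i)) ≡ h p
  ∑<-multiples-block p@(suc p-1) h = begin
    ∑< p G                        ≡⟨ cong (λ n → ∑< n G) (+-comm 1 p-1) ⟩
    ∑< (p-1 + 1) G                ≡⟨ ∑<-+ p-1 1 G ⟩
    ∑< p-1 G + (G (p-1 + 0) + 0)  ≡⟨ cong₂ _+_ (∑<-zero p-1 below-p) (+-identityʳ _) ⟩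
    G (p-1 + 0)                   ≡⟨ cong G (+-identityʳ p-1) ⟩
    iverson (p ∣? p) * h p        ≡⟨ cong (_* h p) (iverson-yes (p ∣? p) ∣-refl) ⟩
    h p + 0                       ≡⟨ +-identityʳ (h p) ⟩
    h p                           ∎
    where
    open ≡-Reasoning
    G : ℕ → ℕ
    G i = iverson (p ∣? suc i) * h (suc i)
    below-p : ∀ i → i < p-1 → G i ≡ 0
    below-p i i<p-1 = cong (_* h (suc i)) (iverson-no (p ∣? suc i) (λ p∣1+i → <⇒≱ (s<s i<p-1) (∣⇒≤ p∣1+i)))

  ∑<-multiples : ∀ p j .{{_ : NonZero p}} (h : ℕ → ℕ) →
    ∑< (j * p) (λ i → iverson (p ∣? suc i) * h (suc i)) ≡ ∑< j (λ i → h (suc i * p))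
  ∑<-multiples p zero    h = refl
  ∑<-multiples p (suc j) h = begin
    ∑< (p + j * p) G                                                  ≡⟨ ∑<-+ p (j * p) G ⟩
    ∑< p G + ∑< (j * p) (λ i → G (p + i))                             ≡⟨ cong₂ _+_ first-block (∑<-cong (j * p) shift) ⟩
    h (1 * p) + ∑< (j * p) (λ i → iverson (p ∣? suc i) * h (p + suc i)) ≡⟨ cong (h (1 * p) +_) (∑<-multiples p j (λ k → h (p + k))) ⟩
    h (1 * p) + ∑< j (λ i → h (suc (suc i) * p))                      ∎
    where
    open ≡-Reasoning
    G : ℕ → ℕ
    G i = iverson (p ∣? suc i) * h (suc i)
    first-block : ∑< p G ≡ h (1 * p)
    first-block = trans (∑<-multiples-block p h) (cong h (sym (*-identityˡ p)))
    shift : ∀ i → i < j * p → G (p + i) ≡ iverson (p ∣? suc i) * h (p + suc i)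
    shift i _ rewrite sym (+-suc p i) =
      cong (_* h (p + suc i)) (iverson-cong (p ∣? p + suc i) (p ∣? suc i) (mk⇔ (λ p∣ → ∣m+n∣m⇒∣n p∣ ∣-refl) (∣m∣n⇒∣m+n ∣-refl)))

  length-filter-applyUpTo : ∀ {p} {P : ℕ → Set p} (P? : Decidable P) f n →
    length (filter P? (applyUpTo f n)) ≡ ∑< n (λ i → iverson (P? (f i)))
  length-filter-applyUpTo P? f zero = refl
  length-filter-applyUpTo P? f (suc n) with does (P? (f 0))
  ... | true  = cong suc (length-filter-applyUpTo P? (f ∘ suc) n)
  ... | false = length-filter-applyUpTo P? (f ∘ suc) n

  φ≡∑<-coprime : ∀ m → φ m ≡ ∑< m (λ i → iverson (coprime? (suc i) m))
  φ≡∑<-coprime m = trans (cong (length ∘ filter (λ k → gcd k m ≟ 1)) (map-upTo suc m))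
                         (length-filter-applyUpTo (λ k → gcd k m ≟ 1) suc m)

  coprime-*⇔ : ∀ {k m n} → Coprime k (m * n) ⇔ (Coprime k m × Coprime k n)
  coprime-*⇔ {k} {m} {n} = mk⇔
    (λ c → (λ {d} (d∣k , d∣m) → c (d∣k , ∣m⇒∣m*n n d∣m)) , (λ {d} (d∣k , d∣n) → c (d∣k , ∣n⇒∣m*n m d∣n)))
    (λ (c-m , c-n) {d} (d∣k , d∣mn) → c-n (d∣k , Coprime.coprime-divisor (λ {e} (e∣d , e∣m) → c-m (∣-trans e∣d d∣k , e∣m)) d∣mn))

  coprime-prime⇔∤ : ∀ {k p} → Prime p → Coprime k p ⇔ (¬ p ∣ k)
  coprime-prime⇔∤ p-prime = mk⇔
    (λ c p∣k → nonTrivial⇒≢1 {{prime⇒nonTrivial p-prime}} (c (p∣k , ∣-refl)))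
    (λ p∤k {d} (d∣k , d∣p) → [ (λ d≡1 → d≡1) , (λ { refl → contradiction d∣k p∤k }) ]′ (prime⇒irreducible p-prime d∣p))

  coprime-+ˡ⇔ : ∀ {k m} → Coprime (m + k) m ⇔ Coprime k m
  coprime-+ˡ⇔ {k} {m} = mk⇔ (λ (c : Coprime (m + k) m) {d} (d∣k , d∣m) → c (∣m∣n⇒∣m+n d∣m d∣k , d∣m)) coprime-+

  coprime-*ʳ⇔ : ∀ {k m n} → Coprime n m → Coprime (k * n) m ⇔ Coprime k m
  coprime-*ʳ⇔ {k} {m} {n} c-nm = mk⇔
    (λ (c : Coprime (k * n) m) {d} (d∣k , d∣m) → c (∣m⇒∣m*n n d∣k , d∣m))
    (λ c-km → Coprime.sym {m} {k * n} (Equivalence.from coprime-*⇔ (Coprime.sym {k} {m} c-km , Coprime.sym {n} {m} c-nm)))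

  iverson-coprime-prime-* : ∀ {p} → Prime p → ∀ m k →
    iverson (coprime? k (p * m)) + iverson (p ∣? k) * iverson (coprime? k m) ≡ iverson (coprime? k m)
  iverson-coprime-prime-* {p} p-prime m k with p ∣? k
  ... | yes p∣k = begin
    iverson (coprime? k (p * m)) + (iverson (coprime? k m) + 0) ≡⟨ cong₂ _+_ (iverson-no (coprime? k (p * m)) ¬coprime) (+-identityʳ _) ⟩
    iverson (coprime? k m)                                      ∎
    where
    open ≡-Reasoning
    ¬coprime : ¬ Coprime k (p * m)
    ¬coprime c = Equivalence.to (coprime-prime⇔∤ p-prime) (proj₁ (Equivalence.to (coprime-*⇔ {k} {p} {m}) c)) p∣k
  ... | no p∤k = trans (+-identityʳ _) (iverson-cong (coprime? k (p * m)) (coprime? k m) (mk⇔ {A = Coprime k (p * m)} {B = Coprime k m}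
    (λ c → proj₂ (Equivalence.to (coprime-*⇔ {k} {p} {m}) c))
    (λ c → Equivalence.from (coprime-*⇔ {k} {p} {m}) (Equivalence.from (coprime-prime⇔∤ p-prime) p∤k , c))))

  -- Of 1, …, pm exactly p φ(m) are prime to m, and those among them divisible by p are the jp with j prime to m.
  φ-prime-* : ∀ {p m} → Prime p → ¬ p ∣ m → φ (p * m) + φ m ≡ p * φ m
  φ-prime-* {p} {m} p-prime p∤m = begin
    φ (p * m) + φ m
      ≡⟨ cong₂ _+_ (φ≡∑<-coprime (p * m)) (sym multiples-of-p) ⟩
    ∑< (p * m) (λ i → χ (p * m) i) + ∑< (p * m) (λ i → iverson (p ∣? suc i) * χ m i)
      ≡⟨ sym (∑<-distrib (p * m) _ _) ⟩
    ∑< (p * m) (λ i → χ (p * m) i + iverson (p ∣? suc i) * χ m i)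
      ≡⟨ ∑<-cong (p * m) (λ i _ → iverson-coprime-prime-* p-prime m (suc i)) ⟩
    ∑< (p * m) (χ m)
      ≡⟨ ∑<-periodic m p (λ i → iverson-cong (coprime? (suc (m + i)) m) (coprime? (suc i) m) (shift i)) ⟩
    p * ∑< m (χ m)
      ≡⟨ cong (p *_) (φ≡∑<-coprime m) ⟨
    p * φ m ∎
    where
    open ≡-Reasoning
    instance _ = prime⇒nonZero p-prime
    χ : ℕ → ℕ → ℕ
    χ n i = iverson (coprime? (suc i) n)
    shift : ∀ i → Coprime (suc (m + i)) m ⇔ Coprime (suc i) m
    shift i rewrite sym (+-suc m i) = coprime-+ˡ⇔
    multiples-of-p : ∑< (p * m) (λ i → iverson (p ∣? suc i) * χ m i) ≡ φ m
    multiples-of-p = begin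
      ∑< (p * m) (λ i → iverson (p ∣? suc i) * χ m i) ≡⟨ cong (λ n → ∑< n (λ i → iverson (p ∣? suc i) * χ m i)) (*-comm p m) ⟩
      ∑< (m * p) (λ i → iverson (p ∣? suc i) * χ m i) ≡⟨ ∑<-multiples p m (λ k → iverson (coprime? k m)) ⟩
      ∑< m (λ i → iverson (coprime? (suc i * p) m))   ≡⟨ ∑<-cong m (λ i _ → iverson-cong (coprime? (suc i * p) m) (coprime? (suc i) m) (coprime-*ʳ⇔ p-coprime-m)) ⟩
      ∑< m (χ m)                                      ≡⟨ φ≡∑<-coprime m ⟨
      φ m                                             ∎
      where
      p-coprime-m : Coprime p m
      p-coprime-m = Coprime.sym (Equivalence.from (coprime-prime⇔∤ p-prime) p∤m)

module DistinctPrimes where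
  open import Data.Nat.Base
  open import Data.Nat.Properties using (*-commutativeSemigroup; <⇒≢)
  open import Data.Nat.Divisibility using (_∣_; ∣1⇒≡1)
  open import Data.Nat.Primality using (Prime; prime⇒irreducible; prime⇒nonTrivial; euclidsLemma)
  open import Data.Nat.ListAction using (product)
  open import Data.Fin.Base using (Fin; zero; suc; punchIn; punchOut)
  open import Data.Fin.Properties using (punchIn-punchOut; punchInᵢ≢i; punchIn-injective)
  import Data.Fin.Base as Fin
  import Data.Fin.Properties as Fin
  open import Relation.Binary.Definitions using (tri<; tri≈; tri>)
  open import Data.List.Base using ([]; _∷_; tabulate)
  open import Data.List.Relation.Unary.All using (All; []; _∷_)
  open import Data.List.Relation.Unary.All.Properties using (tabulate⁺)
  open import Data.Product.Base using (∃; _×_; _,_)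
  open import Data.Sum.Base using ([_,_]′)
  open import Function.Base using (_∘_)
  open import Function.Definitions using (Injective)
  open import Relation.Nullary using (¬_; contradiction)
  open import Relation.Binary.PropositionalEquality
  open import Algebra.Properties.CommutativeSemigroup *-commutativeSemigroup using (x∙yz≈y∙xz)

  <-preserving⇒injective : ∀ {r} (f : Fin r → ℕ) → (∀ i j → i Fin.< j → f i < f j) → Injective _≡_ _≡_ f
  <-preserving⇒injective f f-preserves-< {i} {j} fi≡fj with Fin.<-cmp i j
  ... | tri< i<j _ _ = contradiction fi≡fj (<⇒≢ (f-preserves-< i j i<j))
  ... | tri≈ _ i≡j _ = i≡j
  ... | tri> _ _ j<i = contradiction (sym fi≡fj) (<⇒≢ (f-preserves-< j i j<i))

  prime∣prime⇒≡ : ∀ {p q} → Prime p → Prime q → p ∣ q → p ≡ q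
  prime∣prime⇒≡ p-prime q-prime p∣q =
    [ (λ p≡1 → contradiction p≡1 (nonTrivial⇒≢1 {{prime⇒nonTrivial p-prime}})) , (λ p≡q → p≡q) ]′
    (prime⇒irreducible q-prime p∣q)

  prime∤product : ∀ {p ns} → Prime p → All Prime ns → All (p ≢_) ns → ¬ p ∣ product ns
  prime∤product {ns = []}     p-prime []                  []             p∣1 =
    nonTrivial⇒≢1 {{prime⇒nonTrivial p-prime}} (∣1⇒≡1 p∣1)
  prime∤product {ns = n ∷ ns} p-prime (n-prime ∷ primes) (p≢n ∷ p≢ns) p∣n*ns =
    [ p≢n ∘ prime∣prime⇒≡ p-prime n-prime , prime∤product p-prime primes p≢ns ]′
    (euclidsLemma n (product ns) p-prime p∣n*ns)

  product-tabulate-punchIn : ∀ {n} (f : Fin (suc n) → ℕ) i →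
    product (tabulate f) ≡ f i * product (tabulate (f ∘ punchIn i))
  product-tabulate-punchIn f zero = refl
  product-tabulate-punchIn {suc n} f (suc i) = trans
    (cong (f zero *_) (product-tabulate-punchIn (f ∘ suc) i))
    (x∙yz≈y∙xz (f zero) (f (suc i)) _)

  product-of-distinct-primes-split : ∀ {r} (f : Fin r → ℕ) → (∀ i → Prime (f i)) → Injective _≡_ _≡_ f →
    ∀ {a b} → a ≢ b → ∃ λ m → product (tabulate f) ≡ f a * (f b * m) × ¬ f a ∣ m × ¬ f b ∣ m
  product-of-distinct-primes-split {suc zero} f _ _ {zero} {zero} a≢b = contradiction refl a≢b
  product-of-distinct-primes-split {suc (suc r)} f primes f-injective {a} {b} a≢b =
    product (tabulate (f ∘ ι))
    , trans (product-tabulate-punchIn f a) (cong (f a *_) (trans (product-tabulate-punchIn (f ∘ punchIn a) b′) (cong (_* product (tabulate (f ∘ ι))) f-b′)))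
    , prime∤product (primes a) (tabulate⁺ (primes ∘ ι)) (tabulate⁺ (λ i → punchInᵢ≢i a _ ∘ sym ∘ f-injective))
    , prime∤product (primes b) (tabulate⁺ (primes ∘ ι)) (tabulate⁺ λ i → punchInᵢ≢i b′ i ∘ sym ∘ punchIn-injective a _ _ ∘ f-injective ∘ trans f-b′)
    where
    b′ : Fin (suc r)
    b′ = punchOut a≢b
    ι : Fin r → Fin (suc (suc r))
    ι = punchIn a ∘ punchIn b′
    f-b′ : f (punchIn a b′) ≡ f b
    f-b′ = cong f (punchIn-punchOut a≢b)

module RationalCasts where
  open import Data.Nat.Base as ℕ using (suc; NonZero)
  open import Data.Nat.DivMod using (m*n/n≡m)
  open import Data.Nat.Divisibility using (_∣_)
  open import Data.Nat.Primality using (Prime)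
  open import Data.Integer.Base as ℤ using (+_; +<+)
  import Data.Integer.Properties as ℤ
  import Data.Nat.Properties as ℕP
  open import Data.Integer.Tactic.RingSolver using (solve-∀)
  open import Data.Rational.Base using (ℚ; 0ℚ; 1ℚ; _+_; _*_; _-_; -_; _<_; Positive; toℚᵘ)
  open import Data.Rational.Properties
    using (toℚᵘ-injective; toℚᵘ-fromℚᵘ; toℚᵘ-homo-+; toℚᵘ-homo-*; toℚᵘ-cancel-<; normalize-pos; +-identityʳ; +-inverseʳ; +-assoc)
  open import Relation.Nullary using (¬_)
  open import Data.Rational.Unnormalised.Base as ℚᵘ using (ℚᵘ; mkℚᵘ; *≡*; *<*) renaming (_≃_ to _≃ᵘ_)
  open import Data.Rational.Unnormalised.Properties as ℚᵘ using (≃-trans; ≃-sym; <-respˡ-≃; <-respʳ-≃)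
  open import Relation.Binary.PropositionalEquality
  open Totient using (φ-prime-*)

  toℚᵘ-frac : ∀ m d → toℚᵘ (frac m (suc d)) ≃ᵘ mkℚᵘ (+ m) d
  toℚᵘ-frac m d = toℚᵘ-fromℚᵘ (mkℚᵘ (+ m) d)

  toℚᵘ-injective-via : ∀ {p r : ℚ} {x y : ℚᵘ} → toℚᵘ p ≃ᵘ x → toℚᵘ r ≃ᵘ y → x ≃ᵘ y → p ≡ r
  toℚᵘ-injective-via p≃x r≃y x≃y = toℚᵘ-injective (≃-trans p≃x (≃-trans x≃y (≃-sym r≃y)))

  q-+ : ∀ m n → q (m ℕ.+ n) ≡ q m + q n
  q-+ m n = toℚᵘ-injective-via (toℚᵘ-frac (m ℕ.+ n) 0)
    (≃-trans (toℚᵘ-homo-+ (q m) (q n)) (ℚᵘ.+-cong (toℚᵘ-frac m 0) (toℚᵘ-frac n 0)))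
    (*≡* (trans (cong (ℤ._* + 1) (ℤ.pos-+ m n)) (identity (+ m) (+ n))))
    where
    identity : ∀ a b → (a ℤ.+ b) ℤ.* + 1 ≡ (a ℤ.* + 1 ℤ.+ b ℤ.* + 1) ℤ.* + 1
    identity = solve-∀

  q-* : ∀ m n → q (m ℕ.* n) ≡ q m * q n
  q-* m n = toℚᵘ-injective-via (toℚᵘ-frac (m ℕ.* n) 0)
    (≃-trans (toℚᵘ-homo-* (q m) (q n)) (ℚᵘ.*-cong (toℚᵘ-frac m 0) (toℚᵘ-frac n 0)))
    (*≡* (cong (ℤ._* + 1) (ℤ.pos-* m n)))

  frac≡q*frac1 : ∀ m d .{{_ : NonZero d}} → frac m d ≡ q m * frac 1 d
  frac≡q*frac1 m (suc d) = toℚᵘ-injective-via (toℚᵘ-frac m d)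
    (≃-trans (toℚᵘ-homo-* (q m) (frac 1 (suc d))) (ℚᵘ.*-cong (toℚᵘ-frac m 0) (toℚᵘ-frac 1 d)))
    (*≡* (trans (cong (λ k → + m ℤ.* + k) (ℕP.*-identityˡ (suc d))) (identity (+ m) (+ suc d))))
    where
    identity : ∀ a b → a ℤ.* b ≡ (a ℤ.* + 1) ℤ.* b
    identity = solve-∀

  frac1-* : ∀ m n .{{_ : NonZero m}} .{{_ : NonZero n}} → frac 1 (m ℕ.* n) ≡ frac 1 m * frac 1 n
  frac1-* (suc m) (suc n) = toℚᵘ-injective-via (toℚᵘ-frac 1 (n ℕ.+ m ℕ.* suc n))
    (≃-trans (toℚᵘ-homo-* (frac 1 (suc m)) (frac 1 (suc n))) (ℚᵘ.*-cong (toℚᵘ-frac 1 m) (toℚᵘ-frac 1 n)))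
    (*≡* (identity (+ (suc m ℕ.* suc n))))
    where
    identity : ∀ a → + 1 ℤ.* a ≡ (+ 1 ℤ.* + 1) ℤ.* a
    identity = solve-∀

  q*frac1≡1 : ∀ d .{{_ : NonZero d}} → q d * frac 1 d ≡ 1ℚ
  q*frac1≡1 (suc d) = toℚᵘ-injective-via
    (≃-trans (toℚᵘ-homo-* (q (suc d)) (frac 1 (suc d))) (ℚᵘ.*-cong (toℚᵘ-frac (suc d) 0) (toℚᵘ-frac 1 d)))
    (toℚᵘ-frac 1 0)
    (*≡* (trans (identity (+ suc d)) (cong (λ k → + 1 ℤ.* + k) (sym (ℕP.*-identityˡ (suc d))))))
    where
    identity : ∀ a → (a ℤ.* + 1) ℤ.* + 1 ≡ + 1 ℤ.* a
    identity = solve-∀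

  frac-positive : ∀ m d .{{_ : NonZero m}} .{{_ : NonZero d}} → Positive (frac m d)
  frac-positive (suc m) (suc d) = normalize-pos (suc m) (suc d)

  frac1-antitone : ∀ m n .{{_ : NonZero m}} .{{_ : NonZero n}} → m ℕ.< n → frac 1 n < frac 1 m
  frac1-antitone (suc m) (suc n) m<n = toℚᵘ-cancel-<
    (<-respʳ-≃ (≃-sym (toℚᵘ-frac 1 m)) (<-respˡ-≃ (≃-sym (toℚᵘ-frac 1 n))
      (*<* (subst₂ ℤ._<_ (sym (ℤ.*-identityˡ (+ suc m))) (sym (ℤ.*-identityˡ (+ suc n))) (+<+ m<n)))))

  div-*-cancelˡ : ∀ d m .{{_ : NonZero d}} → div (d ℕ.* m) d ≡ m
  div-*-cancelˡ (suc d) m = trans (cong (ℕ._/ suc d) (ℕP.*-comm (suc d) m)) (m*n/n≡m m (suc d))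

  frac-*-cancelˡ : ∀ k m d .{{_ : NonZero k}} .{{_ : NonZero d}} → frac (k ℕ.* m) (k ℕ.* d) ≡ frac m d
  frac-*-cancelˡ (suc k) m (suc d) = toℚᵘ-injective-via (toℚᵘ-frac (suc k ℕ.* m) (d ℕ.+ k ℕ.* suc d)) (toℚᵘ-frac m d)
    (*≡* (trans (cong (ℤ._* + suc d) (ℤ.pos-* (suc k) m))
         (trans (identity (+ suc k) (+ m) (+ suc d)) (cong (+ m ℤ.*_) (sym (ℤ.pos-* (suc k) (suc d)))))))
    where
    identity : ∀ a b c → a ℤ.* b ℤ.* c ≡ b ℤ.* (a ℤ.* c)
    identity = solve-∀

  φ-prime-*-ℚ : ∀ {p m} → Prime p → ¬ p ∣ m → q (φ (p ℕ.* m)) ≡ q p * q (φ m) - q (φ m)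
  φ-prime-*-ℚ {p} {m} p-prime p∤m = begin
    q (φ (p ℕ.* m))                             ≡⟨ +-identityʳ (q (φ (p ℕ.* m))) ⟨
    q (φ (p ℕ.* m)) + 0ℚ                        ≡⟨ cong (_+_ (q (φ (p ℕ.* m)))) (+-inverseʳ (q (φ m))) ⟨
    q (φ (p ℕ.* m)) + (q (φ m) - q (φ m))       ≡⟨ +-assoc (q (φ (p ℕ.* m))) (q (φ m)) (- q (φ m)) ⟨
    q (φ (p ℕ.* m)) + q (φ m) - q (φ m)         ≡⟨ cong (_- q (φ m)) (q-+ (φ (p ℕ.* m)) (φ m)) ⟨
    q (φ (p ℕ.* m) ℕ.+ φ m) - q (φ m)           ≡⟨ cong (λ n → q n - q (φ m)) (φ-prime-* p-prime p∤m) ⟩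
    q (p ℕ.* φ m) - q (φ m)                     ≡⟨ cong (_- q (φ m)) (q-* p (φ m)) ⟩
    q p * q (φ m) - q (φ m)                     ∎
    where open ≡-Reasoning

module CutSetFormulas where
  open import Data.Rational.Base using (ℚ; 0ℚ; 1ℚ; _+_; _*_; _-_)
  open import Data.Rational.Properties using (+-identityʳ; *-zeroˡ; *-zeroʳ)
  open import Data.Rational.Solver using (module +-*-Solver)
  open import Relation.Binary.PropositionalEquality

  θ-formula : (F K A B D f R y : ℚ) → ℚ
  θ-formula F K A B D f R y = F + K * (A * (q 1 - y) + B * (q 1 - f) + D * (q 1 - y) + R)

  β-formula : (F K m⁻¹ Q B m : ℚ) → ℚ
  β-formula F K m⁻¹ Q B m = F + K * m⁻¹ * (Q + B * (m - q 2))

  α-formula : (aᵐ b⁻¹ A W : ℚ) → ℚ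
  α-formula aᵐ b⁻¹ A W = (q 2 + (aᵐ - q 2) * b⁻¹) * A - W

  θ-formula≡β-formula+slope : ∀ (F K A W a b m m⁻¹ b⁻¹ y : ℚ) {B D Q aᵐ f R : ℚ} →
    B ≡ b * A - A → D ≡ a * A - A → Q ≡ b * W → aᵐ ≡ a * m →
    f ≡ q 2 * (m⁻¹ * y) → R ≡ b * W * (m⁻¹ * y) →
    m * m⁻¹ ≡ 1ℚ → b * b⁻¹ ≡ 1ℚ →
    θ-formula F K A B D f R y ≡ β-formula F K m⁻¹ Q B m + K * b * m⁻¹ * α-formula aᵐ b⁻¹ A W * (1ℚ - y)
  θ-formula≡β-formula+slope F K A W a b m m⁻¹ b⁻¹ y refl refl refl refl refl refl mm⁻¹≡1 bb⁻¹≡1 =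
    trans expand (trans (cong₂ (λ u v → RHS + defect u v) mm⁻¹≡1 bb⁻¹≡1) (trans (cong (RHS +_) defect-vanishes) (+-identityʳ RHS)))
    where
    open +-*-Solver
    RHS : ℚ
    RHS = β-formula F K m⁻¹ (b * W) (b * A - A) m + K * b * m⁻¹ * α-formula (a * m) b⁻¹ A W * (1ℚ - y)
    -- the difference of the two sides as long as m⁻¹ and b⁻¹ are not known to be inverses
    defect : ℚ → ℚ → ℚ
    defect u v = K * ((1ℚ - u) * ((b - 1ℚ) * A + a * A * (1ℚ - y)) + (v - 1ℚ) * ((1ℚ - y) * A * (q 2 * m⁻¹ - a * u)))
    expand : θ-formula F K A (b * A - A) (a * A - A) (q 2 * (m⁻¹ * y)) (b * W * (m⁻¹ * y)) y ≡ RHS + defect (m * m⁻¹) (b * b⁻¹)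
    expand = solve 10 (λ F K A W a b m m⁻¹ b⁻¹ y →
        F :+ K :* (A :* (con (q 1) :- y) :+ (b :* A :- A) :* (con (q 1) :- con (q 2) :* (m⁻¹ :* y)) :+ (a :* A :- A) :* (con (q 1) :- y) :+ b :* W :* (m⁻¹ :* y))
      := F :+ K :* m⁻¹ :* (b :* W :+ (b :* A :- A) :* (m :- con (q 2))) :+ K :* b :* m⁻¹ :* ((con (q 2) :+ (a :* m :- con (q 2)) :* b⁻¹) :* A :- W) :* (con 1ℚ :- y)
         :+ K :* ((con 1ℚ :- m :* m⁻¹) :* ((b :- con 1ℚ) :* A :+ a :* A :* (con 1ℚ :- y)) :+ (b :* b⁻¹ :- con 1ℚ) :* ((con 1ℚ :- y) :* A :* (con (q 2) :* m⁻¹ :- a :* (m :* m⁻¹)))))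
      refl F K A W a b m m⁻¹ b⁻¹ y
    defect-vanishes : defect 1ℚ 1ℚ ≡ 0ℚ
    defect-vanishes = trans (cong (K *_) (cong₂ _+_ (*-zeroˡ ((b - 1ℚ) * A + a * A * (1ℚ - y)))
                                                     (*-zeroˡ ((1ℚ - y) * A * (q 2 * m⁻¹ - a * 1ℚ)))))
                            (*-zeroʳ K)

module AffineSequences where
  open import Data.Nat.Base as ℕ using (ℕ)
  open import Data.Product.Base using (_×_; _,_)
  open import Data.Rational.Base using (ℚ; 0ℚ; 1ℚ; _+_; _*_; _-_; _<_; Positive; positive; negative)
  open import Data.Rational.Properties
    using (+-identityʳ; *-zeroˡ; *-zeroʳ; +-monoʳ-<; neg-antimono-<; *-monoʳ-<-pos; *-monoʳ-<-neg)
  open import Relation.Binary.PropositionalEquality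

  affine-trichotomy : ∀ (β κ α : ℚ) .{{_ : Positive κ}} (y θ : ℕ → ℚ) →
    y 0 ≡ 1ℚ → (∀ t → y (t ℕ.+ 1) < y t) → (∀ t → θ t ≡ β + κ * α * (1ℚ - y t)) →
    (α ≡ 0ℚ → β ≡ θ 1 × ∀ t → θ t ≡ θ (t ℕ.+ 1))
    × (α < 0ℚ → θ 1 < β × ∀ t → θ (t ℕ.+ 1) < θ t)
    × (0ℚ < α → β < θ 1 × ∀ t → θ t < θ (t ℕ.+ 1))
  affine-trichotomy β κ α y θ y₀≡1 y-decreasing θ≡ =
    (λ α≡0 → trans (sym β≡θ₀) (constant α≡0 0) , constant α≡0)
    , (λ α<0 → subst (θ 1 <_) β≡θ₀ (decreasing α<0 0) , decreasing α<0)
    , (λ 0<α → subst (_< θ 1) β≡θ₀ (increasing 0<α 0) , increasing 0<α)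
    where
    β≡θ₀ : θ 0 ≡ β
    β≡θ₀ = trans (θ≡ 0) (trans (cong (λ z → β + κ * α * (1ℚ - z)) y₀≡1)
                  (trans (cong (β +_) (*-zeroʳ (κ * α))) (+-identityʳ β)))
    flat : α ≡ 0ℚ → ∀ t → θ t ≡ β
    flat refl t = trans (θ≡ t) (trans (cong (λ c → β + c * (1ℚ - y t)) (*-zeroʳ κ))
                                      (trans (cong (β +_) (*-zeroˡ (1ℚ - y t))) (+-identityʳ β)))
    1-y-increasing : ∀ t → 1ℚ - y t < 1ℚ - y (t ℕ.+ 1)
    1-y-increasing t = +-monoʳ-< 1ℚ (neg-antimono-< (y-decreasing t))
    constant : α ≡ 0ℚ → ∀ t → θ t ≡ θ (t ℕ.+ 1)
    constant α≡0 t = trans (flat α≡0 t) (sym (flat α≡0 (t ℕ.+ 1)))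
    decreasing : α < 0ℚ → ∀ t → θ (t ℕ.+ 1) < θ t
    decreasing α<0 t rewrite θ≡ t | θ≡ (t ℕ.+ 1) =
      +-monoʳ-< β (*-monoʳ-<-neg (κ * α) {{negative κα<0}} (1-y-increasing t))
      where
      κα<0 : κ * α < 0ℚ
      κα<0 = subst (κ * α <_) (*-zeroʳ κ) (*-monoʳ-<-pos κ α<0)
    increasing : 0ℚ < α → ∀ t → θ t < θ (t ℕ.+ 1)
    increasing 0<α t rewrite θ≡ t | θ≡ (t ℕ.+ 1) =
      +-monoʳ-< β (*-monoʳ-<-pos (κ * α) {{positive 0<κα}} (1-y-increasing t))
      where
      0<κα : 0ℚ < κ * α
      0<κα = subst (_< κ * α) (*-zeroʳ κ) (*-monoʳ-<-pos κ 0<α)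

open import Data.Nat.Base as ℕ using (ℕ)
open import Data.Nat.Divisibility using (_∣_)
open import Data.Nat.Primality using (Prime)
open import Data.Fin.Base using (Fin)
open import Relation.Nullary using (¬_)
open import Relation.Binary.PropositionalEquality using (_≡_; refl)

^-pred : ∀ m n → 1 ℕ.≤ n → m ℕ.^ n ≡ m ℕ.* m ℕ.^ (n ℕ.∸ 1)
^-pred m (ℕ.suc n) _ = refl

module CutSets {r : ℕ} (p e : Fin r → ℕ) (primes : ∀ i → Prime (p i)) {a b : Fin r} (1≤ea : 1 ℕ.≤ e a)
               (P′ : ℕ) (P≡pa*[pb*P′] : Setup.P p e ≡ p a ℕ.* (p b ℕ.* P′)) (pa∤P′ : ¬ p a ∣ P′) (pb∤P′ : ¬ p b ∣ P′) where
  open import Data.Nat.Base using (NonZero; z<s; nonTrivial⇒n>1)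
  import Data.Nat.Properties as ℕP
  open import Data.Nat.Properties using (m^n≢0; m*n≢0; ^-monoʳ-<; m<m+n)
  open import Data.Nat.Primality using (prime⇒nonZero; prime⇒nonTrivial; productOfPrimes≢0)
  open import Data.Nat.ListAction.Properties using (product≢0)
  import Data.List.Relation.Unary.All.Properties as All
  open import Data.Rational.Base using (ℚ; 1ℚ; _+_; _*_; _-_; _<_; Positive)
  open import Data.Rational.Properties using (pos*pos⇒pos)
  open import Relation.Binary.PropositionalEquality using (sym; trans; cong; cong₂; module ≡-Reasoning)
  open import Algebra.Properties.CommutativeSemigroup ℕP.*-commutativeSemigroup using (x∙yz≈y∙xz)
  open Totient using (φ-prime-*)
  open RationalCasts
  open CutSetFormulas
  open Setup p e

  M : ℕ
  M = p a ℕ.^ (e a ℕ.∸ 1)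

  instance
    pa≢0 : NonZero (p a)
    pa≢0 = prime⇒nonZero (primes a)
    pb≢0 : NonZero (p b)
    pb≢0 = prime⇒nonZero (primes b)
    M≢0 : NonZero M
    M≢0 = m^n≢0 (p a) (e a ℕ.∸ 1)
    N≢0 : NonZero N
    N≢0 = product≢0 (All.map⁺ (All.tabulate⁺ (λ i → m^n≢0 (p i) (e i) {{prime⇒nonZero (primes i)}})))
    P≢0 : NonZero P
    P≢0 = productOfPrimes≢0 (All.map⁺ (All.tabulate⁺ primes))

  pa^ea≡pa*M : p a ℕ.^ e a ≡ p a ℕ.* M
  pa^ea≡pa*M = ^-pred (p a) (e a) 1≤ea

  P/pa≡pb*P′ : div P (p a) ≡ p b ℕ.* P′
  P/pa≡pb*P′ = trans (cong (λ n → div n (p a)) P≡pa*[pb*P′]) (div-*-cancelˡ (p a) _)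

  P/pb≡pa*P′ : div P (p b) ≡ p a ℕ.* P′
  P/pb≡pa*P′ = trans (cong (λ n → div n (p b)) (trans P≡pa*[pb*P′] (x∙yz≈y∙xz (p a) (p b) P′))) (div-*-cancelˡ (p b) _)

  P/[pa*pb]≡P′ : div P (p a ℕ.* p b) ≡ P′
  P/[pa*pb]≡P′ = trans (cong (λ n → div n (p a ℕ.* p b)) (trans P≡pa*[pb*P′] (sym (ℕP.*-assoc (p a) (p b) P′))))
                     (div-*-cancelˡ (p a ℕ.* p b) P′ {{m*n≢0 (p a) (p b)}})

  y : ℕ → ℚ
  y t = frac 1 (p b ℕ.^ t)

  κ : ℚ
  κ = frac N P * q (p b) * frac 1 M

  φ[P/pa]≡ : q (φ (div P (p a))) ≡ q (p b) * q (φ (div P (p a ℕ.* p b))) - q (φ (div P (p a ℕ.* p b)))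
  φ[P/pa]≡ = trans (cong (λ n → q (φ n)) P/pa≡pb*P′)
    (trans (φ-prime-*-ℚ (primes b) pb∤P′) (cong (λ n → q (p b) * q (φ n) - q (φ n)) (sym P/[pa*pb]≡P′)))

  φ[P/pb]≡ : q (φ (div P (p b))) ≡ q (p a) * q (φ (div P (p a ℕ.* p b))) - q (φ (div P (p a ℕ.* p b)))
  φ[P/pb]≡ = trans (cong (λ n → q (φ n)) P/pb≡pa*P′)
    (trans (φ-prime-*-ℚ (primes a) pa∤P′) (cong (λ n → q (p a) * q (φ n) - q (φ n)) (sym P/[pa*pb]≡P′)))

  q[P/pa]≡ : q (div P (p a)) ≡ q (p b) * q (div P (p a ℕ.* p b))
  q[P/pa]≡ = trans (cong q P/pa≡pb*P′) (trans (q-* (p b) P′) (cong (λ n → q (p b) * q n) (sym P/[pa*pb]≡P′)))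

  q[pa^ea]≡ : q (p a ℕ.^ e a) ≡ q (p a) * q M
  q[pa^ea]≡ = trans (cong q pa^ea≡pa*M) (q-* (p a) M)

  frac[P/pa^ea*pb^t]≡ : ∀ t → frac P (p a ℕ.^ e a ℕ.* p b ℕ.^ t) ≡ q (p b) * q (div P (p a ℕ.* p b)) * (frac 1 M * y t)
  frac[P/pa^ea*pb^t]≡ t = begin
    frac P (p a ℕ.^ e a ℕ.* p b ℕ.^ t)                     ≡⟨ cong₂ frac P≡pa*[pb*P′] (trans (cong (ℕ._* p b ℕ.^ t) pa^ea≡pa*M) (ℕP.*-assoc (p a) M _)) ⟩
    frac (p a ℕ.* (p b ℕ.* P′)) (p a ℕ.* (M ℕ.* p b ℕ.^ t)) ≡⟨ frac-*-cancelˡ (p a) (p b ℕ.* P′) (M ℕ.* p b ℕ.^ t) ⟩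
    frac (p b ℕ.* P′) (M ℕ.* p b ℕ.^ t)                    ≡⟨ frac≡q*frac1 (p b ℕ.* P′) (M ℕ.* p b ℕ.^ t) ⟩
    q (p b ℕ.* P′) * frac 1 (M ℕ.* p b ℕ.^ t)              ≡⟨ cong₂ _*_ (q-* (p b) P′) (frac1-* M (p b ℕ.^ t)) ⟩
    q (p b) * q P′ * (frac 1 M * y t)                      ≡⟨ cong (λ n → q (p b) * q n * (frac 1 M * y t)) P/[pa*pb]≡P′ ⟨
    q (p b) * q (div P (p a ℕ.* p b)) * (frac 1 M * y t)  ∎
    where
    open ≡-Reasoning
    instance
      _ = m^n≢0 (p b) t
      _ = m*n≢0 M (p b ℕ.^ t)

  frac[2/M*pb^t]≡ : ∀ t → frac 2 (M ℕ.* p b ℕ.^ t) ≡ q 2 * (frac 1 M * y t)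
  frac[2/M*pb^t]≡ t = trans (frac≡q*frac1 2 (M ℕ.* p b ℕ.^ t)) (cong (q 2 *_) (frac1-* M (p b ℕ.^ t)))
    where
    instance
      _ = m^n≢0 (p b) t
      _ = m*n≢0 M (p b ℕ.^ t)

  -- The arguments are spelled exactly as in Defs: rationals that agree only after unfolding
  -- would be compared by normalising them, which is hopelessly slow.
  θ≡β+κα[1-y] : ∀ t → θ a b t ≡ β a + κ * α a b * (1ℚ - y t)
  θ≡β+κα[1-y] t = θ-formula≡β-formula+slope
    (q (φ N)) (frac N P) (q (φ (div P (p a ℕ.* p b)))) (q (div P (p a ℕ.* p b)))
    (q (p a)) (q (p b)) (q M) (frac 1 M) (frac 1 (p b)) (y t)
    φ[P/pa]≡ φ[P/pb]≡ q[P/pa]≡ q[pa^ea]≡ (frac[2/M*pb^t]≡ t) (frac[P/pa^ea*pb^t]≡ t) (q*frac1≡1 M) (q*frac1≡1 (p b))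

  κ-positive : Positive κ
  κ-positive = pos*pos⇒pos (frac N P * q (p b)) {{pos*pos⇒pos (frac N P) {{frac-positive N P}} (q (p b)) {{frac-positive (p b) 1}}}}
                           (frac 1 M) {{frac-positive 1 M}}

  y-decreasing : ∀ t → y (t ℕ.+ 1) < y t
  y-decreasing t = frac1-antitone (p b ℕ.^ t) (p b ℕ.^ (t ℕ.+ 1))
    (^-monoʳ-< (p b) (nonTrivial⇒n>1 (p b) {{prime⇒nonTrivial (primes b)}}) (m<m+n t z<s))
    where
    instance
      _ = m^n≢0 (p b) t
      _ = m^n≢0 (p b) (t ℕ.+ 1)

open import Data.Nat.ListAction using (product)
open import Data.List.Properties using (map-tabulate)
open import Function.Base using (id; _∘_)
open import Relation.Binary.PropositionalEquality using (trans; cong)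
open DistinctPrimes using (<-preserving⇒injective; product-of-distinct-primes-split)
open AffineSequences using (affine-trichotomy)
open import Data.Product.Base using (_,_; map₂)

open import Data.Nat as ℕ using (ℕ; _≤_; _∸_; _+_; suc)
open import Data.Nat.Primality using (Prime)
open import Data.Fin as Fin using (Fin)
open import Data.Rational as ℚ using (ℚ; 0ℚ)
open import Data.Product using (_×_)
open import Relation.Binary.PropositionalEquality using (_≡_; _≢_)

proposition4p3 : (r : ℕ) → 3 ≤ r → (p e : Fin r → ℕ)
    → (∀ i → Prime (p i)) → (∀ i j → i Fin.< j → p i ℕ.< p j) → (∀ i → 1 ≤ e i)
    → (a b : Fin r) → a ≢ b → 2 ≤ e b
    → (Setup.α p e a b ≡ 0ℚ
         → Setup.β p e a ≡ Setup.θ p e a b 1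
           × (∀ t → 1 ≤ t → t + 1 ≤ e b ∸ 1 → Setup.θ p e a b t ≡ Setup.θ p e a b (t + 1)))
    × (Setup.α p e a b ℚ.< 0ℚ
         → Setup.θ p e a b 1 ℚ.< Setup.β p e a
           × (∀ t → 1 ≤ t → t + 1 ≤ e b ∸ 1 → Setup.θ p e a b (t + 1) ℚ.< Setup.θ p e a b t))
    × (0ℚ ℚ.< Setup.α p e a b
         → Setup.β p e a ℚ.< Setup.θ p e a b 1
           × (∀ t → 1 ≤ t → t + 1 ≤ e b ∸ 1 → Setup.θ p e a b t ℚ.< Setup.θ p e a b (t + 1)))
-- Destructured by let: a with-abstraction over this goal has the same normalisation problem.
proposition4p3 r _ p e primes p-increasing 1≤e a b a≢b _ =
  let P′ , P≡pa*[pb*P′] , pa∤P′ , pb∤P′ = product-of-distinct-primes-split p primes (<-preserving⇒injective p p-increasing) a≢b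
      open Setup p e
      open CutSets p e primes (1≤e a) P′ (trans (cong product (map-tabulate id p)) P≡pa*[pb*P′]) pa∤P′ pb∤P′
      equal , decreasing , increasing = affine-trichotomy (β a) κ (α a b) {{κ-positive}} y (θ a b) refl y-decreasing θ≡β+κα[1-y]
  in map₂ (λ step t _ _ → step t) ∘ equal
   , map₂ (λ step t _ _ → step t) ∘ decreasing
   , map₂ (λ step t _ _ → step t) ∘ increasing
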